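{- Consider the following seven Boolean networks $(f_1,f_2)$ on two vertices (each having $(0,0)$ as unique attractor under parallel update): $[6,00]$: $f_1=x_1\land x_2,f_2=x_1\land\neg x_2$; $[7,00]$: $f_1=f_2=x_1\land\neg x_2$; $[11,00]$: $f_1=\neg x_1\land x_2,f_2=x_1\land x_2$; $[16,00]$: $f_1=x_1\oplus x_2,f_2=x_1\land\neg x_2$; $[19,00]$: $f_1=f_2=\neg x_1\land x_2$; $[22,00]$: $f_1=\neg x_1\land x_2,f_2=x_1\oplus x_2$; $[25,00]$: $f_1=f_2=x_1\oplus x_2$. For each of them there exist delay vectors $dt=(\alpha,\beta)$ such that the MBN built on it with delays $dt$ admits a limit cycle.
   Context: The MBN built on a two-vertex Boolean network $(f_1,f_2)$ with delay vector $(\alpha,\beta)$ of positive integers has configurations $(\rho,\gamma)$ with $0\le\rho\le\alpha$, $0\le\gamma\le\beta$, underlying Boolean state $x=([\rho\ge1],[\gamma\ge1])$, and dynamics: the first coordinate becomes $\alpha$ if $f_1(x)=1$, else $\max(\rho-1,0)$; the second becomes $\beta$ if $f_2(x)=1$, else $\max(\gamma-1,0)$. Attractors are periodic orbits: fixed points (length 1) and limit cycles (length $\ge2$). $\oplus$ is exclusive or. -}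

module Defs where

open import Data.Bool using (Bool; true; false; _∧_; not; _xor_; if_then_else_)
open import Data.Nat using (ℕ; zero; suc; _≤_; _<_; _∸_; pred)
open import Data.Product using (_×_; _,_; Σ; ∃; ∃-syntax)
open import Relation.Binary.PropositionalEquality using (_≡_; _≢_)

BN₂ : Set
BN₂ = (Bool → Bool → Bool) × (Bool → Bool → Bool)

pos : ℕ → Bool
pos zero    = false
pos (suc _) = true

-- Configurations (ρ , γ); the bounds 0 ≤ ρ ≤ α, 0 ≤ γ ≤ β are imposed separately.
Config : Set
Config = ℕ × ℕ

mbnStep : BN₂ → ℕ → ℕ → Config → Config
mbnStep (f₁ , f₂) α β (ρ , γ) =
  (if f₁ (pos ρ) (pos γ) then α else ρ ∸ 1) ,
  (if f₂ (pos ρ) (pos γ) then β else γ ∸ 1)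

iter : ℕ → (Config → Config) → Config → Config
iter zero    F c = c
iter (suc k) F c = F (iter k F c)

InRange : ℕ → ℕ → Config → Set
InRange α β (ρ , γ) = (ρ ≤ α) × (γ ≤ β)

HasPeriod : (Config → Config) → Config → ℕ → Set
HasPeriod F c p =
  (1 ≤ p) × (iter p F c ≡ c) × (∀ k → 1 ≤ k → k < p → iter k F c ≢ c)

HasLimitCycle : BN₂ → ℕ → ℕ → Set
HasLimitCycle f α β =
  Σ Config λ c → InRange α β c × Σ ℕ λ p → (2 ≤ p) × HasPeriod (mbnStep f α β) c p

LimitCycleForSomeDelays : BN₂ → Set
LimitCycleForSomeDelays f =
  ∃[ α ] ∃[ β ] (1 ≤ α) × (1 ≤ β) × HasLimitCycle f α β

bn6 bn7 bn11 bn16 bn19 bn22 bn25 : BN₂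
bn6  = (λ x₁ x₂ → x₁ ∧ x₂)         , (λ x₁ x₂ → x₁ ∧ not x₂)
bn7  = (λ x₁ x₂ → x₁ ∧ not x₂)     , (λ x₁ x₂ → x₁ ∧ not x₂)
bn11 = (λ x₁ x₂ → not x₁ ∧ x₂)     , (λ x₁ x₂ → x₁ ∧ x₂)
bn16 = (λ x₁ x₂ → x₁ xor x₂)       , (λ x₁ x₂ → x₁ ∧ not x₂)
bn19 = (λ x₁ x₂ → not x₁ ∧ x₂)     , (λ x₁ x₂ → not x₁ ∧ x₂)
bn22 = (λ x₁ x₂ → not x₁ ∧ x₂)     , (λ x₁ x₂ → x₁ xor x₂)
bn25 = (λ x₁ x₂ → x₁ xor x₂)       , (λ x₁ x₂ → x₁ xor x₂)

{-# OPTIONS --safe #-}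
module Submission where

open import Defs
open import Data.Nat using (zero; suc; _≤_; _<_; z≤n; s≤s)
open import Data.Product using (_×_; _,_)
open import Relation.Binary.PropositionalEquality using (_≡_; _≢_; refl)

-- With delay 2
-- on one vertex, once that vertex is switched on it stays active for one more
-- step, during which it re-triggers itself or the other vertex; this yields an
-- explicit orbit of length 2 (length 3 for [16,00]), verified by computation.

period-two : ∀ {F : Config → Config} {c : Config} →
             iter 2 F c ≡ c → F c ≢ c → HasPeriod F c 2
period-two {F} {c} back moved = s≤s z≤n , back , early
  where
  early : ∀ k → 1 ≤ k → k < 2 → iter k F c ≢ c
  early (suc zero)    _ _ = moved
  early (suc (suc _)) _ (s≤s (s≤s ()))

period-three : ∀ {F : Config → Config} {c : Config} →
               iter 3 F c ≡ c → F c ≢ c → F (F c) ≢ c → HasPeriod F c 3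
period-three {F} {c} back moved₁ moved₂ = s≤s z≤n , back , early
  where
  early : ∀ k → 1 ≤ k → k < 3 → iter k F c ≢ c
  early (suc zero)          _ _ = moved₁
  early (suc (suc zero))    _ _ = moved₂
  early (suc (suc (suc _))) _ (s≤s (s≤s (s≤s ())))

limitCycle-of : ∀ f α β (c : Config) {p} → 1 ≤ α → 1 ≤ β → InRange α β c →
                2 ≤ p → HasPeriod (mbnStep f α β) c p → LimitCycleForSomeDelays f
limitCycle-of f α β c {p} α≥1 β≥1 c∈ p≥2 period = α , β , α≥1 , β≥1 , c , c∈ , p , p≥2 , period

proposition5 : LimitCycleForSomeDelays bn6 × LimitCycleForSomeDelays bn7
    × LimitCycleForSomeDelays bn11 × LimitCycleForSomeDelays bn16
    × LimitCycleForSomeDelays bn19 × LimitCycleForSomeDelays bn22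
    × LimitCycleForSomeDelays bn25
proposition5 =
    limitCycle-of bn6 2 1 (1 , 1) one one (one , one) two (period-two refl λ ())
  , limitCycle-of bn7 2 1 (1 , 0) one one (one , z≤n) two (period-two refl λ ())
  , limitCycle-of bn11 1 2 (0 , 2) one one (z≤n , two) two (period-two refl λ ())
  , limitCycle-of bn16 1 2 (0 , 1) one one (z≤n , one) two (period-three refl (λ ()) λ ())
  , limitCycle-of bn19 1 2 (0 , 1) one one (z≤n , one) two (period-two refl λ ())
  , limitCycle-of bn22 1 2 (0 , 1) one one (z≤n , one) two (period-two refl λ ())
  , limitCycle-of bn25 1 2 (0 , 1) one one (z≤n , one) two (period-two refl λ ())
  where
  one : ∀ {n} → 1 ≤ suc n
  one = s≤s z≤n
  two : ∀ {n} → 2 ≤ suc (suc n)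
  two = s≤s (s≤s z≤n)
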